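{- Work in Bishop-style constructive mathematics. The principle "every pointwise continuous function $f\colon\mathbb{N}^{\mathbb{N}}\to\mathbb{N}$ from Baire space to the discrete space $\mathbb{N}$ is strongly continuous" is equivalent to the principle "every monotone $\Pi^0_1$ bar of the binary fan $\{0,1\}^*$ is uniform".
   Context: $\mathbb{N}^*$ is the set of finite sequences of natural numbers, $\{0,1\}^*$ the finite binary sequences, $a*b$ concatenation, $\overline{\alpha}n$ the initial segment of length $n$ of $\alpha$. A tree is an inhabited decidable subset of $\mathbb{N}^*$ closed under initial segments; a spread is a tree $T$ with $\forall a\in T\,\exists n\,(a*\langle n\rangle\in T)$; a path of $T$ is $\alpha$ with $\forall n\,(\overline{\alpha}n\in T)$. For a spread $T$, $P\subseteq T$ is a bar if every path $\alpha$ of $T$ has some $n$ with $\overline{\alpha}n\in P$; a uniform bar if there is $N$ such that every path of $T$ has some $n\le N$ with $\overline{\alpha}n\in P$; $\Pi^0_1$ if $P=\bigcap_n B_n$ with each $B_n\subseteq T$ decidable; monotone if $a\in P$, $a*b\in T$ imply $a*b\in P$. Baire space has metric $d(\alpha,\beta)=\inf\{2^{ -n}\mid\overline{\alpha}n=\overline{\beta}n\}$. A compact metric space is a complete totally bounded one; a subset $L$ of a metric space $X$ is a compact image if $L=g[K]$ for a compact metric space $K$ and uniformly continuous $g\colon K\to X$. A function $f\colon X\to Y$ between metric spaces is strongly continuous if for each compact image $L\subseteq X$ and each $\varepsilon>0$ there is $\delta>0$ such that for all $x,u\in X$, $x\in L$ and $d_X(x,u)<\delta$ imply $d_Y(f(x),f(u))<\varepsilon$.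 -}

module Defs where

open import Level using (0ℓ)
open import Data.Nat as ℕ using (ℕ; zero; suc)
open import Data.Integer using (+_)
open import Data.Rational using (ℚ; 0ℚ; 1ℚ; ½; _+_; _-_; _*_; ∣_∣; _≤_; _<_; _/_)
open import Data.List using (List; _++_; applyUpTo)
open import Data.List.Relation.Unary.All using (All)
open import Data.List.Membership.Propositional using (_∈_)
open import Data.Product using (Σ; ∃; _×_; _,_)
open import Relation.Nullary using (yes; no)
open import Relation.Unary using (Pred; Decidable)
open import Relation.Binary.PropositionalEquality using (_≡_)

-- Bishop reals (regular Cauchy sequences of rationals), 0-indexed:
-- a real is x : ℕ → ℚ with |x m - x n| ≤ 1/(m+1) + 1/(n+1).

RSeq : Set
RSeq = ℕ → ℚ

inv : ℕ → ℚ
inv n = + 1 / suc n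

IsRegular : RSeq → Set
IsRegular x = ∀ m n → ∣ x m - x n ∣ ≤ inv m + inv n

record ℝ : Set where
  field
    seq : RSeq
    reg : IsRegular seq
open ℝ public

const : ℚ → RSeq
const q _ = q

0ₛ : RSeq
0ₛ = const 0ℚ

_<ₛ_ : RSeq → RSeq → Set
x <ₛ y = ∃ λ n → x n + inv n + inv n < y n

_≤ₛ_ : RSeq → RSeq → Set
x ≤ₛ y = ∀ n → x n ≤ y n + inv n + inv n

_≃ₛ_ : RSeq → RSeq → Set
x ≃ₛ y = ∀ n → ∣ x n - y n ∣ ≤ inv n + inv n

-- Bishop addition (index shifted so the sum is again regular)
_+ₛ_ : RSeq → RSeq → RSeq
(x +ₛ y) n = x (suc (n ℕ.+ n)) + y (suc (n ℕ.+ n))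

Positive : ℝ → Set
Positive ε = 0ₛ <ₛ seq ε

-- Metric spaces: a carrier with a real-valued distance; the equality of
-- the space is x = y  iff  d x y = 0.

record MetricSpace : Set₁ where
  field
    Carrier : Set
    d       : Carrier → Carrier → RSeq

record IsMetric (X : MetricSpace) : Set where
  open MetricSpace X
  field
    d-regular  : ∀ x y → IsRegular (d x y)
    d-nonneg   : ∀ x y → 0ₛ ≤ₛ d x y
    d-refl     : ∀ x → d x x ≃ₛ 0ₛ
    d-sym      : ∀ x y → d x y ≃ₛ d y x
    d-triangle : ∀ x y z → d x z ≤ₛ (d x y +ₛ d y z)

module _ (X : MetricSpace) where
  open MetricSpace X

  _≈_ : Carrier → Carrier → Set
  x ≈ y = d x y ≃ₛ 0ₛ

  IsCauchy : (ℕ → Carrier) → Set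
  IsCauchy s = ∀ (ε : ℝ) → Positive ε →
    ∃ λ N → ∀ m n → N ℕ.≤ m → N ℕ.≤ n → d (s m) (s n) <ₛ seq ε

  ConvergesTo : (ℕ → Carrier) → Carrier → Set
  ConvergesTo s x = ∀ (ε : ℝ) → Positive ε →
    ∃ λ N → ∀ n → N ℕ.≤ n → d (s n) x <ₛ seq ε

  IsComplete : Set
  IsComplete = ∀ s → IsCauchy s → ∃ λ x → ConvergesTo s x

  IsTotallyBounded : Set
  IsTotallyBounded = ∀ (ε : ℝ) → Positive ε →
    ∃ λ (as : List Carrier) → ∀ x → ∃ λ a → a ∈ as × d x a <ₛ seq ε

record CompactMetricSpace : Set₁ where
  field
    space          : MetricSpace
    isMetric       : IsMetric space
    complete       : IsComplete space
    totallyBounded : IsTotallyBounded space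
  open MetricSpace space public

UniformlyContinuous : (K X : MetricSpace) →
  (MetricSpace.Carrier K → MetricSpace.Carrier X) → Set
UniformlyContinuous K X g = ∀ (ε : ℝ) → Positive ε →
  ∃ λ (δ : ℝ) → Positive δ × (∀ x y → MetricSpace.d K x y <ₛ seq δ →
    MetricSpace.d X (g x) (g y) <ₛ seq ε)

IsCompactImage : (X : MetricSpace) → Pred (MetricSpace.Carrier X) 0ℓ → Set₁
IsCompactImage X L =
  Σ CompactMetricSpace λ K →
  Σ (CompactMetricSpace.Carrier K → MetricSpace.Carrier X) λ g →
    UniformlyContinuous (CompactMetricSpace.space K) X g ×
    (∀ x → (L x → ∃ λ k → _≈_ X x (g k)) × ((∃ λ k → _≈_ X x (g k)) → L x))

PointwiseContinuous : (X Y : MetricSpace) →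
  (MetricSpace.Carrier X → MetricSpace.Carrier Y) → Set
PointwiseContinuous X Y f = ∀ x (ε : ℝ) → Positive ε →
  ∃ λ (δ : ℝ) → Positive δ × (∀ u → MetricSpace.d X x u <ₛ seq δ →
    MetricSpace.d Y (f x) (f u) <ₛ seq ε)

StronglyContinuous : (X Y : MetricSpace) →
  (MetricSpace.Carrier X → MetricSpace.Carrier Y) → Set₁
StronglyContinuous X Y f =
  ∀ (L : Pred (MetricSpace.Carrier X) 0ℓ) → IsCompactImage X L →
  ∀ (ε : ℝ) → Positive ε →
  ∃ λ (δ : ℝ) → Positive δ × (∀ x u → L x → MetricSpace.d X x u <ₛ seq δ →
    MetricSpace.d Y (f x) (f u) <ₛ seq ε)

-- Baire space with d(α,β) = inf {2^-n | ᾱn = β̄n}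

pow2inv : ℕ → ℚ
pow2inv zero    = 1ℚ
pow2inv (suc n) = ½ * pow2inv n

-- n-th approximation of d(α,β): 2^-j if j < n is the first index where
-- α and β differ, and 0 if ᾱn = β̄n  (error ≤ 2^-n ≤ 1/(n+1))
baireDistApprox : (ℕ → ℕ) → (ℕ → ℕ) → ℕ → ℕ → ℚ
baireDistApprox α β j zero = 0ℚ
baireDistApprox α β j (suc k) with α j ℕ.≟ β j
... | yes _ = baireDistApprox α β (suc j) k
... | no  _ = pow2inv j

Baire : MetricSpace
Baire = record { Carrier = ℕ → ℕ ; d = λ α β n → baireDistApprox α β 0 n }

discreteDist : ℕ → ℕ → ℚ
discreteDist m n with m ℕ.≟ n
... | yes _ = 0ℚ
... | no  _ = 1ℚ

ℕdisc : MetricSpace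
ℕdisc = record { Carrier = ℕ ; d = λ m n → const (discreteDist m n) }

initSeg : (ℕ → ℕ) → ℕ → List ℕ
initSeg α n = applyUpTo α n

BinFan : Pred (List ℕ) 0ℓ
BinFan a = All (λ x → x ℕ.≤ 1) a

IsPath : (ℕ → ℕ) → Set
IsPath α = ∀ n → BinFan (initSeg α n)

IsBar : Pred (List ℕ) 0ℓ → Set
IsBar P = ∀ α → IsPath α → ∃ λ n → P (initSeg α n)

IsUniformBar : Pred (List ℕ) 0ℓ → Set
IsUniformBar P = ∃ λ N → ∀ α → IsPath α → ∃ λ n → n ℕ.≤ N × P (initSeg α n)

IsΠ⁰₁ : Pred (List ℕ) 0ℓ → Set₁
IsΠ⁰₁ P = Σ (ℕ → Pred (List ℕ) 0ℓ) λ B →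
  (∀ n → Decidable (B n)) ×
  (∀ n a → B n a → BinFan a) ×
  (∀ a → (P a → ∀ n → B n a) × ((∀ n → B n a) → P a))

IsMonotone : Pred (List ℕ) 0ℓ → Set
IsMonotone P = ∀ a b → P a → BinFan (a ++ b) → P (a ++ b)

StrongContinuityPrinciple : Set₁
StrongContinuityPrinciple = ∀ (f : (ℕ → ℕ) → ℕ) →
  PointwiseContinuous Baire ℕdisc f → StronglyContinuous Baire ℕdisc f

MonotonePi01BarPrinciple : Set₁
MonotonePi01BarPrinciple = ∀ (P : Pred (List ℕ) 0ℓ) →
  (∀ a → P a → BinFan a) → IsΠ⁰₁ P → IsMonotone P → IsBar P → IsUniformBar P

-- Both principles are about agreement of initial segments.  We first relate
-- the Baire distance to agreement (d(x,y) < 2^-J forces x̄J = ȳJ, and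
-- agreement below the precision of ε gives d(x,y) < ε); consequently a
-- continuity estimate for f : ℕ^ℕ → ℕ says that f is constant on the
-- sequences sharing a long enough initial segment (locally, or uniformly on a
-- set L).
--
-- SCP ⇒ MPB: the Cantor space is compact and its image contains the binary
-- sequences.  For a monotone bar P = ⋂ₙ Bₙ we build a locally constant test
-- probing Bₘ at the first non-binary entry m + 2 of a sequence; a uniform
-- modulus N of the test on the binary sequences shows that N bounds the bar.
--
-- MPB ⇒ SCP: for a compact image L = g[K], total boundedness of K and uniform
-- continuity of g give finitely many candidates for each coordinate of the
-- points of L.  Binary words code choices of candidates; the codes whose
-- decoding f cannot tell apart from its prolongations form a monotone Π⁰₁
-- bar, and its uniform bound is a uniform modulus of f on L.
module Submission where

open import Defs
open import Data.Product using (_×_; _,_)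

module Scales where
  open import Data.Nat as ℕ using (ℕ; zero; suc)
  import Data.Nat.Properties as ℕP
  open import Data.Integer as ℤ using (+_)
  open import Data.Rational
    using (ℚ; 0ℚ; 1ℚ; ½; _+_; _-_; _*_; -_; ∣_∣; _≤_; _<_; mkℚ; toℚᵘ; *≤*; *<*)
  open import Data.Rational.Properties
  import Data.Rational.Unnormalised as ℚᵘ
  import Data.Rational.Unnormalised.Properties as ℚᵘP
  open import Data.Nat.Coprimality using (1-coprimeTo)
  open import Relation.Binary.PropositionalEquality
  open import Relation.Nullary using (¬_)

  inv≡ : ∀ n → inv n ≡ mkℚ (+ 1) n (1-coprimeTo (suc n))
  inv≡ n = normalize-coprime (1-coprimeTo (suc n))

  inv-pos : ∀ n → 0ℚ < inv n
  inv-pos n rewrite inv≡ n = *<* (ℤ.+<+ (ℕ.s≤s ℕ.z≤n))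

  inv-nonneg : ∀ n → 0ℚ ≤ inv n
  inv-nonneg n = <⇒≤ (inv-pos n)

  inv-anti : ∀ {m n} → m ℕ.≤ n → inv n ≤ inv m
  inv-anti {m} {n} m≤n rewrite inv≡ m | inv≡ n =
    *≤* (ℤ.+≤+ (ℕ.s≤s (ℕP.+-mono-≤ m≤n ℕ.z≤n)))

  inv-strict : ∀ {m n} → m ℕ.< n → inv n < inv m
  inv-strict {m} {n} m<n rewrite inv≡ m | inv≡ n =
    *<* (ℤ.+<+ (ℕ.s≤s (ℕP.+-mono-≤ m<n ℕ.z≤n)))

  half-inv : ∀ m → ½ * inv m ≡ inv (m ℕ.+ suc m)
  half-inv m = toℚᵘ-injective (begin
    toℚᵘ (½ * inv m)                      ≈⟨ toℚᵘ-homo-* ½ (inv m) ⟩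
    toℚᵘ ½ ℚᵘ.* toℚᵘ (inv m)              ≡⟨ cong (λ q → toℚᵘ ½ ℚᵘ.* toℚᵘ q) (inv≡ m) ⟩
    ℚᵘ.mkℚᵘ (+ 1) 1 ℚᵘ.* ℚᵘ.mkℚᵘ (+ 1) m  ≈⟨ ℚᵘ.*≡* (cong (λ k → + suc (m ℕ.+ k ℕ.+ 0 ℕ.* suc (m ℕ.+ k)))
                                                           (sym (ℕP.*-identityˡ (suc m)))) ⟩
    ℚᵘ.mkℚᵘ (+ 1) (m ℕ.+ suc m)           ≡⟨ cong toℚᵘ (sym (inv≡ (m ℕ.+ suc m))) ⟩
    toℚᵘ (inv (m ℕ.+ suc m))              ∎)
    where open ℚᵘP.≃-Reasoning

  -- 2^j - 1, so that 2^-j = 1/((2^j - 1) + 1)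
  twoPowPred : ℕ → ℕ
  twoPowPred zero    = zero
  twoPowPred (suc j) = twoPowPred j ℕ.+ suc (twoPowPred j)

  pow2inv≡inv : ∀ j → pow2inv j ≡ inv (twoPowPred j)
  pow2inv≡inv zero    = refl
  pow2inv≡inv (suc j) = trans (cong (½ *_) (pow2inv≡inv j)) (half-inv (twoPowPred j))

  twoPowPred-mono : ∀ {i j} → i ℕ.≤ j → twoPowPred i ℕ.≤ twoPowPred j
  twoPowPred-mono {zero}  _             = ℕ.z≤n
  twoPowPred-mono {suc i} (ℕ.s≤s i≤j) =
    ℕP.+-mono-≤ (twoPowPred-mono i≤j) (ℕ.s≤s (twoPowPred-mono i≤j))

  twoPowPred-≥ : ∀ j → j ℕ.≤ twoPowPred j
  twoPowPred-≥ zero    = ℕ.z≤n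
  twoPowPred-≥ (suc j) =
    ℕP.≤-trans (ℕ.s≤s (twoPowPred-≥ j)) (ℕP.m≤n+m (suc (twoPowPred j)) (twoPowPred j))

  pow2inv-pos : ∀ j → 0ℚ < pow2inv j
  pow2inv-pos j rewrite pow2inv≡inv j = inv-pos (twoPowPred j)

  pow2inv-nonneg : ∀ j → 0ℚ ≤ pow2inv j
  pow2inv-nonneg j = <⇒≤ (pow2inv-pos j)

  pow2inv-anti : ∀ {i j} → i ℕ.≤ j → pow2inv j ≤ pow2inv i
  pow2inv-anti {i} {j} i≤j rewrite pow2inv≡inv i | pow2inv≡inv j = inv-anti (twoPowPred-mono i≤j)

  pow2inv≤inv : ∀ n → pow2inv n ≤ inv n
  pow2inv≤inv n rewrite pow2inv≡inv n = inv-anti (twoPowPred-≥ n)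

  finer : ℕ → ℕ
  finer J = suc (twoPowPred J) ℕ.+ suc (suc (twoPowPred J))

  finer-precise : ∀ J → inv (finer J) + inv (finer J) < pow2inv J
  finer-precise J =
    subst₂ _<_ twice (sym (pow2inv≡inv J)) (inv-strict (ℕP.n<1+n (twoPowPred J)))
    where
    r : ℚ
    r = inv (suc (twoPowPred J))
    twice : r ≡ inv (finer J) + inv (finer J)
    twice = begin
      r                              ≡⟨ sym (*-identityˡ r) ⟩
      (½ + ½) * r                    ≡⟨ *-distribʳ-+ r ½ ½ ⟩
      ½ * r + ½ * r                  ≡⟨ cong₂ _+_ (half-inv (suc (twoPowPred J))) (half-inv (suc (twoPowPred J))) ⟩
      inv (finer J) + inv (finer J)  ∎
      where open ≡-Reasoning

  finer-> : ∀ J → J ℕ.< finer J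
  finer-> J = ℕP.≤-trans (ℕ.s≤s (twoPowPred-≥ J)) (ℕP.m≤m+n (suc (twoPowPred J)) _)

  p≤p+q : ∀ p q → 0ℚ ≤ q → p ≤ p + q
  p≤p+q p q 0≤q = subst (_≤ p + q) (+-identityʳ p) (+-monoʳ-≤ p 0≤q)

  q≤p+q : ∀ p q → 0ℚ ≤ p → q ≤ p + q
  q≤p+q p q 0≤p = subst (q ≤_) (+-comm q p) (p≤p+q q p 0≤p)

  p≤p+2inv : ∀ p n → p ≤ p + inv n + inv n
  p≤p+2inv p n = ≤-trans (p≤p+q p (inv n) (inv-nonneg n)) (p≤p+q (p + inv n) (inv n) (inv-nonneg n))

  nonneg+nonneg : ∀ p q → 0ℚ ≤ p → 0ℚ ≤ q → 0ℚ ≤ p + q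
  nonneg+nonneg p q 0≤p 0≤q = ≤-trans 0≤p (p≤p+q p q 0≤q)

  inv+inv-nonneg : ∀ m n → 0ℚ ≤ inv m + inv n
  inv+inv-nonneg m n = nonneg+nonneg _ _ (inv-nonneg m) (inv-nonneg n)

  ∣p-p∣≡0 : ∀ p → ∣ p - p ∣ ≡ 0ℚ
  ∣p-p∣≡0 p = cong ∣_∣ (+-inverseʳ p)

  ∣p-0∣≡p : ∀ p → 0ℚ ≤ p → ∣ p - 0ℚ ∣ ≡ p
  ∣p-0∣≡p p 0≤p = trans (cong ∣_∣ (+-identityʳ p)) (0≤p⇒∣p∣≡p 0≤p)

  ∣0-p∣≡p : ∀ p → 0ℚ ≤ p → ∣ 0ℚ - p ∣ ≡ p
  ∣0-p∣≡p p 0≤p = trans (cong ∣_∣ (+-identityˡ (- p))) (trans (∣-p∣≡∣p∣ p) (0≤p⇒∣p∣≡p 0≤p))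

  ¬1+2inv<½ : ∀ n → ¬ (1ℚ + inv n + inv n < pow2inv 1)
  ¬1+2inv<½ n lt = <-irrefl refl (<-≤-trans (≤-<-trans (p≤p+2inv 1ℚ n) lt) (pow2inv-anti {0} {1} ℕ.z≤n))

  constℝ : ℚ → ℝ
  constℝ q = record
    { seq = const q
    ; reg = λ m n → subst (_≤ inv m + inv n) (sym (∣p-p∣≡0 q)) (inv+inv-nonneg m n) }

  pow2invℝ : ℕ → ℝ
  pow2invℝ J = constℝ (pow2inv J)

  pow2invℝ-pos : ∀ J → Positive (pow2invℝ J)
  pow2invℝ-pos J =
    finer J , subst (_< pow2inv J) (sym (cong (_+ inv (finer J)) (+-identityˡ (inv (finer J)))))
                    (finer-precise J)

open Scales

module FirstFailure where
  open import Data.Nat using (ℕ; zero; suc; s≤s; _≤_; _<_; _<?_; _≟_)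
  open import Data.Nat.Properties using (<-cmp; m≤n⇒m≤1+n; n<1+n; ≤∧≢⇒<; ≮⇒≥)
  open import Data.Empty using (⊥-elim)
  open import Relation.Nullary using (¬_; Dec; yes; no)
  open import Relation.Binary.PropositionalEquality using (_≡_; refl)
  open import Relation.Binary.Definitions using (tri<; tri≈; tri>)

  Below : (ℕ → Set) → ℕ → Set
  Below R n = ∀ i → i < n → R i

  FailsFirstAt : (ℕ → Set) → ℕ → Set
  FailsFirstAt R j = Below R j × ¬ R j

  failure-beyond : ∀ {R n j} → Below R n → ¬ R j → n ≤ j
  failure-beyond {n = n} {j} below ¬Rj with j <? n
  ... | yes j<n = ⊥-elim (¬Rj (below j j<n))
  ... | no  j≮n = ≮⇒≥ j≮n

  failsFirstAt-unique : ∀ {R j j′} → FailsFirstAt R j → FailsFirstAt R j′ → j ≡ j′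
  failsFirstAt-unique {j = j} {j′} (below , ¬Rj) (below′ , ¬Rj′) with <-cmp j j′
  ... | tri< j<j′ _ _ = ⊥-elim (¬Rj (below′ j j<j′))
  ... | tri≈ _ j≡j′ _ = j≡j′
  ... | tri> _ _ j′<j = ⊥-elim (¬Rj′ (below j′ j′<j))

  data Search (R : ℕ → Set) (n : ℕ) : Set where
    holdsBelow : Below R n → Search R n
    failsAt    : ∀ j → j < n → FailsFirstAt R j → Search R n

  search : ∀ {R} → (∀ i → Dec (R i)) → ∀ n → Search R n
  search R? zero = holdsBelow (λ i ())
  search {R} R? (suc n) with search R? n
  ... | failsAt j j<n fails = failsAt j (m≤n⇒m≤1+n j<n) fails
  ... | holdsBelow below with R? n
  ...   | no  ¬Rn = failsAt n (n<1+n n) (below , ¬Rn)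
  ...   | yes Rn  = holdsBelow below′
    where
    below′ : Below R (suc n)
    below′ i (s≤s i≤n) with i ≟ n
    ... | yes refl = Rn
    ... | no  i≢n  = below i (≤∧≢⇒< i≤n i≢n)

open FirstFailure

module BaireDistance where
  open import Data.Nat as ℕ using (ℕ; zero; suc; z≤n; s≤s; _≤_; _<_; _≟_; _<?_)
  import Data.Nat.Properties as ℕP
  open import Data.Rational as ℚ using (ℚ; 0ℚ; _+_; _-_; ∣_∣)
  import Data.Rational.Properties as ℚP
  open import Data.Product using (proj₁)
  open import Data.Empty using (⊥-elim)
  open import Relation.Nullary using (yes; no)
  open import Relation.Binary.PropositionalEquality

  Agree : (ℕ → ℕ) → (ℕ → ℕ) → ℕ → Set
  Agree x y = Below (λ i → x i ≡ y i)

  FirstDifference : (ℕ → ℕ) → (ℕ → ℕ) → ℕ → Set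
  FirstDifference x y = FailsFirstAt (λ i → x i ≡ y i)

  agree-sym : ∀ {x y n} → Agree x y n → Agree y x n
  agree-sym ag i i<n = sym (ag i i<n)

  agree-≤ : ∀ {x y m n} → m ≤ n → Agree x y n → Agree x y m
  agree-≤ m≤n ag i i<m = ag i (ℕP.<-≤-trans i<m m≤n)

  approx : (ℕ → ℕ) → (ℕ → ℕ) → ℕ → ℚ
  approx x y n = baireDistApprox x y 0 n

  private
    -- the recursion of baireDistApprox started at position j, run for k steps
    -- (the value q is an index so that 'with' can abstract over it)
    data StepView (x y : ℕ → ℕ) (j k : ℕ) (q : ℚ) : Set where
      same : (∀ i → j ≤ i → i < j ℕ.+ k → x i ≡ y i) → q ≡ 0ℚ → StepView x y j k q
      diff : ∀ d → j ≤ d → d < j ℕ.+ k → (∀ i → j ≤ i → i < d → x i ≡ y i) → x d ≢ y d →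
             q ≡ pow2inv d → StepView x y j k q

    stepView : ∀ x y j k → StepView x y j k (baireDistApprox x y j k)
    stepView x y j zero = same (λ i j≤i i<j+0 → ⊥-elim (ℕP.<-irrefl refl
      (ℕP.≤-<-trans j≤i (subst (i <_) (ℕP.+-identityʳ j) i<j+0)))) refl
    stepView x y j (suc k) with x j ≟ y j
    ... | no xj≢yj = diff j ℕP.≤-refl (ℕP.m<m+n j (s≤s z≤n))
                          (λ i j≤i i<j → ⊥-elim (ℕP.<-irrefl refl (ℕP.≤-<-trans j≤i i<j))) xj≢yj refl
    ... | yes xj≡yj with stepView x y (suc j) k
    ...   | same ag eq = same agFromj eq
      where
      agFromj : ∀ i → j ≤ i → i < j ℕ.+ suc k → x i ≡ y i
      agFromj i j≤i i< with i ≟ j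
      ... | yes refl = xj≡yj
      ... | no  i≢j  = ag i (ℕP.≤∧≢⇒< j≤i (λ eq → i≢j (sym eq))) (subst (i <_) (ℕP.+-suc j k) i<)
    ...   | diff d sj≤d d< ag xd≢yd eq =
      diff d (ℕP.<⇒≤ sj≤d) (subst (d <_) (sym (ℕP.+-suc j k)) d<) agFromj xd≢yd eq
      where
      agFromj : ∀ i → j ≤ i → i < d → x i ≡ y i
      agFromj i j≤i i<d with i ≟ j
      ... | yes refl = xj≡yj
      ... | no  i≢j  = ag i (ℕP.≤∧≢⇒< j≤i (λ eq → i≢j (sym eq))) i<d

  data DistView (x y : ℕ → ℕ) (n : ℕ) : Set where
    agree  : Agree x y n → approx x y n ≡ 0ℚ → DistView x y n
    differ : ∀ d → d < n → FirstDifference x y d → approx x y n ≡ pow2inv d → DistView x y n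

  distView : ∀ x y n → DistView x y n
  distView x y n with stepView x y 0 n
  ... | same ag eq = agree (λ i i<n → ag i z≤n i<n) eq
  ... | diff d _ d<n ag xd≢yd eq = differ d d<n ((λ i i<d → ag i z≤n i<d) , xd≢yd) eq

  agree⇒approx≡0 : ∀ x y n → Agree x y n → approx x y n ≡ 0ℚ
  agree⇒approx≡0 x y n ag with distView x y n
  ... | agree _ eq                 = eq
  ... | differ d d<n (_ , xd≢yd) _ = ⊥-elim (xd≢yd (ag d d<n))

  approx-nonneg : ∀ x y n → 0ℚ ℚ.≤ approx x y n
  approx-nonneg x y n with distView x y n
  ... | agree _ eq       = ℚP.≤-reflexive (sym eq)
  ... | differ d _ _ eq  = subst (0ℚ ℚ.≤_) (sym eq) (pow2inv-nonneg d)

  approx-sym : ∀ x y n → approx x y n ≡ approx y x n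
  approx-sym x y n with distView x y n | distView y x n
  ... | agree _ eq | agree _ eq′ = trans eq (sym eq′)
  ... | agree ag _ | differ d d<n (_ , yd≢xd) _ = ⊥-elim (yd≢xd (sym (ag d d<n)))
  ... | differ d d<n (_ , xd≢yd) _ | agree ag _ = ⊥-elim (xd≢yd (sym (ag d d<n)))
  ... | differ d _ fd eq | differ d′ _ (ag′ , yd′≢xd′) eq′ =
    trans eq (trans (cong pow2inv (failsFirstAt-unique fd (agree-sym ag′ , λ e → yd′≢xd′ (sym e))))
                    (sym eq′))

  difference-visible : ∀ x y {d n} → d < n → x d ≢ y d → pow2inv d ℚ.≤ approx x y n
  difference-visible x y {d} {n} d<n xd≢yd with distView x y n
  ... | agree ag _           = ⊥-elim (xd≢yd (ag d d<n))
  ... | differ d′ _ (ag , _) eq =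
    subst (pow2inv d ℚ.≤_) (sym eq) (pow2inv-anti (failure-beyond ag xd≢yd))

  difference-bound : ∀ x y {i} → x i ≢ y i → ∀ n → pow2inv i ℚ.≤ approx x y n + inv n + inv n
  difference-bound x y {i} xi≢yi n with i ℕ.<? n
  ... | yes i<n = ℚP.≤-trans (difference-visible x y i<n xi≢yi) (p≤p+2inv (approx x y n) n)
  ... | no  i≮n = begin
    pow2inv i                         ≤⟨ pow2inv-anti (ℕP.≮⇒≥ i≮n) ⟩
    pow2inv n                         ≤⟨ pow2inv≤inv n ⟩
    inv n                             ≤⟨ q≤p+q _ (inv n) (nonneg+nonneg _ _ (approx-nonneg x y n) (inv-nonneg n)) ⟩
    approx x y n + inv n + inv n      ∎
    where open ℚP.≤-Reasoning

  approx-regular : ∀ x y m n → ∣ approx x y m - approx x y n ∣ ℚ.≤ inv m + inv n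
  approx-regular x y m n with distView x y m | distView x y n
  ... | agree _ eq | agree _ eq′ rewrite eq | eq′ = inv+inv-nonneg m n
  ... | agree ag eq | differ d _ (_ , xd≢yd) eq′ rewrite eq | eq′ =
    subst (ℚ._≤ inv m + inv n) (sym (∣0-p∣≡p _ (pow2inv-nonneg d)))
      (ℚP.≤-trans (pow2inv-anti (failure-beyond ag xd≢yd))
        (ℚP.≤-trans (pow2inv≤inv m) (p≤p+q (inv m) (inv n) (inv-nonneg n))))
  ... | differ d _ (_ , xd≢yd) eq | agree ag eq′ rewrite eq | eq′ =
    subst (ℚ._≤ inv m + inv n) (sym (∣p-0∣≡p _ (pow2inv-nonneg d)))
      (ℚP.≤-trans (pow2inv-anti (failure-beyond ag xd≢yd))
        (ℚP.≤-trans (pow2inv≤inv n) (q≤p+q (inv m) (inv n) (inv-nonneg m))))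
  ... | differ d _ fd eq | differ d′ _ fd′ eq′ rewrite eq | eq′ | failsFirstAt-unique fd fd′ =
    subst (ℚ._≤ inv m + inv n) (sym (∣p-p∣≡0 (pow2inv d′))) (inv+inv-nonneg m n)

  -- the first difference of x and z is a difference of x, y or of y, z
  approx-triangle : ∀ x y z n →
    approx x z n ℚ.≤ approx x y (suc (n ℕ.+ n)) + approx y z (suc (n ℕ.+ n)) + inv n + inv n
  approx-triangle x y z n = ℚP.≤-trans viaMiddle (p≤p+2inv _ n)
    where
    K : ℕ
    K = suc (n ℕ.+ n)
    <K : ∀ {d} → d < n → d < K
    <K d<n = ℕP.<-trans (ℕP.<-≤-trans d<n (ℕP.m≤m+n n n)) (ℕP.n<1+n (n ℕ.+ n))
    viaMiddle : approx x z n ℚ.≤ approx x y K + approx y z K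
    viaMiddle with distView x z n
    ... | agree _ eq rewrite eq = nonneg+nonneg _ _ (approx-nonneg x y K) (approx-nonneg y z K)
    ... | differ d d<n (_ , xd≢zd) eq rewrite eq with x d ≟ y d
    ...   | no  xd≢yd = ℚP.≤-trans (difference-visible x y (<K d<n) xd≢yd)
                                   (p≤p+q _ _ (approx-nonneg y z K))
    ...   | yes xd≡yd = ℚP.≤-trans (difference-visible y z (<K d<n) (λ e → xd≢zd (trans xd≡yd e)))
                                   (q≤p+q _ _ (approx-nonneg x y K))

  Baire-isMetric : IsMetric Baire
  Baire-isMetric = record
    { d-regular  = approx-regular
    ; d-nonneg   = λ x y n → ℚP.≤-trans (approx-nonneg x y n) (p≤p+2inv _ n)
    ; d-refl     = λ x n → subst (λ q → ∣ q - 0ℚ ∣ ℚ.≤ inv n + inv n)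
                             (sym (agree⇒approx≡0 x x n (λ _ _ → refl))) (inv+inv-nonneg n n)
    ; d-sym      = λ x y n → subst (λ q → ∣ approx x y n - q ∣ ℚ.≤ inv n + inv n) (approx-sym x y n)
                             (subst (ℚ._≤ inv n + inv n) (sym (∣p-p∣≡0 (approx x y n))) (inv+inv-nonneg n n))
    ; d-triangle = approx-triangle
    }

  close⇒agree : ∀ x u J → MetricSpace.d Baire x u <ₛ const (pow2inv J) → Agree x u J
  close⇒agree x u J (n , lt) i i<J with x i ≟ u i
  ... | yes xi≡ui = xi≡ui
  ... | no  xi≢ui = ⊥-elim (ℚP.<-irrefl refl (ℚP.<-≤-trans lt
          (ℚP.≤-trans (pow2inv-anti (ℕP.<⇒≤ i<J)) (difference-bound x u xi≢ui n))))

  agree⇒close : ∀ x u (ε : ℝ) (ε>0 : Positive ε) → Agree x u (proj₁ ε>0) →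
                MetricSpace.d Baire x u <ₛ seq ε
  agree⇒close x u ε (n , lt) ag =
    n , subst (λ q → q + inv n + inv n ℚ.< seq ε n) (sym (agree⇒approx≡0 x u n ag)) lt

  ≈⇒pointwise : ∀ x y → _≈_ Baire x y → ∀ i → x i ≡ y i
  ≈⇒pointwise x y x≈y i with x i ≟ y i
  ... | yes xi≡yi = xi≡yi
  ... | no  xi≢yi = ⊥-elim (ℚP.<-irrefl refl (ℚP.<-≤-trans (finer-precise i)
          (ℚP.≤-trans (difference-visible x y (finer-> i) xi≢yi) small)))
    where
    n : ℕ
    n = finer i
    small : approx x y n ℚ.≤ inv n + inv n
    small = subst (ℚ._≤ inv n + inv n) (∣p-0∣≡p _ (approx-nonneg x y n)) (x≈y n)

  pointwise⇒≈ : ∀ x y → (∀ i → x i ≡ y i) → _≈_ Baire x y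
  pointwise⇒≈ x y x≗y n rewrite agree⇒approx≡0 x y n (λ i _ → x≗y i) = inv+inv-nonneg n n

open BaireDistance

module LocalConstancy where
  open import Level using (0ℓ)
  open import Data.Nat using (ℕ; _≟_)
  open import Data.Rational using (0ℚ; _+_; _<_)
  open import Data.Product using (∃)
  open import Data.Empty using (⊥-elim)
  open import Relation.Nullary using (yes; no)
  open import Relation.Unary using (Pred)
  open import Relation.Binary.PropositionalEquality

  close-values-equal : ∀ a b → MetricSpace.d ℕdisc a b <ₛ const (pow2inv 1) → a ≡ b
  close-values-equal a b (n , lt) with a ≟ b
  ... | yes a≡b = a≡b
  ... | no  _   = ⊥-elim (¬1+2inv<½ n lt)

  equal-values-close : ∀ a b → a ≡ b → (ε : ℝ) → Positive ε → MetricSpace.d ℕdisc a b <ₛ seq ε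
  equal-values-close a .a refl ε (n , lt) = n , subst (λ q → q + inv n + inv n < seq ε n) (sym zero-dist) lt
    where
    zero-dist : discreteDist a a ≡ 0ℚ
    zero-dist with a ≟ a
    ... | yes _   = refl
    ... | no  a≢a = ⊥-elim (a≢a refl)

  LocallyConstant : ((ℕ → ℕ) → ℕ) → Set
  LocallyConstant f = ∀ y → ∃ λ J → ∀ u → Agree y u J → f y ≡ f u

  pointwise⇒locallyConstant : ∀ f → PointwiseContinuous Baire ℕdisc f → LocallyConstant f
  pointwise⇒locallyConstant f cont y with cont y (pow2invℝ 1) (pow2invℝ-pos 1)
  ... | δ , δ>0@(J , _) , estimate =
    J , λ u ag → close-values-equal (f y) (f u) (estimate u (agree⇒close y u δ δ>0 ag))

  locallyConstant⇒pointwise : ∀ f → LocallyConstant f → PointwiseContinuous Baire ℕdisc f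
  locallyConstant⇒pointwise f const-near y ε ε>0 with const-near y
  ... | J , constant =
    pow2invℝ J , pow2invℝ-pos J ,
    λ u close → equal-values-close (f y) (f u) (constant u (close⇒agree y u J close)) ε ε>0

  UniformModulus : Pred (ℕ → ℕ) 0ℓ → ((ℕ → ℕ) → ℕ) → ℕ → Set
  UniformModulus L f N = ∀ x u → L x → Agree x u N → f x ≡ f u

  UniformOn : Pred (ℕ → ℕ) 0ℓ → ((ℕ → ℕ) → ℕ) → ℝ → Set
  UniformOn L f ε = ∃ λ (δ : ℝ) → Positive δ × (∀ x u → L x → MetricSpace.d Baire x u <ₛ seq δ →
                                                   MetricSpace.d ℕdisc (f x) (f u) <ₛ seq ε)

  uniformModulus⇒uniformOn : ∀ {L f N} → UniformModulus L f N → (ε : ℝ) → Positive ε → UniformOn L f ε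
  uniformModulus⇒uniformOn {N = N} constant ε ε>0 =
    pow2invℝ N , pow2invℝ-pos N ,
    λ x u Lx close → equal-values-close _ _ (constant x u Lx (close⇒agree x u N close)) ε ε>0

  uniformOn⇒uniformModulus : ∀ {L f} → UniformOn L f (pow2invℝ 1) → ∃ λ N → UniformModulus L f N
  uniformOn⇒uniformModulus {f = f} (δ , δ>0@(N , _) , estimate) =
    N , λ x u Lx ag → close-values-equal (f x) (f u) (estimate x u Lx (agree⇒close x u δ δ>0 ag))

open LocalConstancy

module Words where
  open import Data.Nat as ℕ using (ℕ; zero; suc; z≤n; s≤s; _≤_; _<_)
  import Data.Nat.Properties as ℕP
  open import Data.List using (List; []; _∷_; _++_; length; upTo; [_]; cartesianProductWith)
  open import Data.List.Relation.Unary.All using (All; []; _∷_)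
  open import Data.List.Relation.Unary.All.Properties using (applyUpTo⁺₁; applyUpTo⁻)
  open import Data.List.Relation.Unary.Any using (here; there)
  open import Data.List.Membership.Propositional using (_∈_)
  open import Data.List.Membership.Propositional.Properties using (∈-cartesianProductWith⁺; ∈-upTo⁺)
  open import Data.Product using (∃)
  open import Relation.Binary.PropositionalEquality using (_≡_; refl; cong; cong₂)

  extend : List ℕ → ℕ → ℕ
  extend []      _       = 0
  extend (v ∷ w) zero    = v
  extend (v ∷ w) (suc i) = extend w i

  extend-++ : ∀ w r {i} → i < length w → extend (w ++ r) i ≡ extend w i
  extend-++ (v ∷ w) r {zero}  _         = refl
  extend-++ (v ∷ w) r {suc i} (s≤s i<n) = extend-++ w r i<n

  extend-initSeg : ∀ x n {i} → i < n → extend (initSeg x n) i ≡ x i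
  extend-initSeg x (suc n) {zero}  _         = refl
  extend-initSeg x (suc n) {suc i} (s≤s i<n) = extend-initSeg (λ j → x (suc j)) n i<n

  extend-∈ : ∀ {v w} → v ∈ w → ∃ λ i → i < length w × extend w i ≡ v
  extend-∈ (here refl) = 0 , s≤s z≤n , refl
  extend-∈ (there v∈w) with extend-∈ v∈w
  ... | i , i<n , eq = suc i , s≤s i<n , eq

  initSeg-cong : ∀ x y n → Agree x y n → initSeg x n ≡ initSeg y n
  initSeg-cong x y zero    _  = refl
  initSeg-cong x y (suc n) ag =
    cong₂ _∷_ (ag 0 (s≤s z≤n))
              (initSeg-cong (λ i → x (suc i)) (λ i → y (suc i)) n (λ i i<n → ag (suc i) (s≤s i<n)))

  initSeg-+ : ∀ x m k → initSeg x (m ℕ.+ k) ≡ initSeg x m ++ initSeg (λ j → x (m ℕ.+ j)) k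
  initSeg-+ x zero    k = refl
  initSeg-+ x (suc m) k = cong (x 0 ∷_) (initSeg-+ (λ i → x (suc i)) m k)

  binary⇒path : ∀ α → (∀ i → α i ≤ 1) → IsPath α
  binary⇒path α bin n = applyUpTo⁺₁ α n (λ {i} _ → bin i)

  path⇒binary : ∀ α → IsPath α → ∀ i → α i ≤ 1
  path⇒binary α path i = applyUpTo⁻ α (suc i) (path (suc i)) (ℕP.n<1+n i)

  words : ℕ → ℕ → List (List ℕ)
  words zero    K = [ [] ]
  words (suc k) K = cartesianProductWith _∷_ (upTo K) (words k K)

  words-complete : ∀ K w → All (_< K) w → w ∈ words (length w) K
  words-complete K []      []           = here refl
  words-complete K (v ∷ w) (v<K ∷ w<K) = ∈-cartesianProductWith⁺ _∷_ (∈-upTo⁺ v<K) (words-complete K w w<K)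

open Words

-- The Cantor space: sequences compared through their binary shadows.  It
-- is a compact metric space whose image in Baire space (under the shadow
-- map) contains every binary sequence.
module CantorSpace where
  open import Level using (0ℓ)
  open import Data.Nat as ℕ using (ℕ; zero; suc; s≤s; _≤_; _⊓_)
  import Data.Nat.Properties as ℕP
  open import Data.List using (map)
  import Data.List.Relation.Unary.All as All
  open import Data.List.Membership.Propositional using (_∈_)
  open import Data.List.Membership.Propositional.Properties using (∈-map⁺)
  open import Data.List.Properties using (length-applyUpTo)
  open import Data.Product using (∃; proj₁; proj₂)
  open import Relation.Unary using (Pred)
  open import Relation.Binary.PropositionalEquality using (_≡_; sym; trans; cong; subst)

  cap : (ℕ → ℕ) → ℕ → ℕ
  cap γ i = γ i ⊓ 1

  cap-binary : ∀ γ i → cap γ i ≤ 1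
  cap-binary γ i = ℕP.m⊓n≤n (γ i) 1

  cap-id : ∀ γ i → γ i ≤ 1 → cap γ i ≡ γ i
  cap-id γ i γi≤1 = ℕP.m≤n⇒m⊓n≡m γi≤1

  cap-idem : ∀ γ i → cap (cap γ) i ≡ cap γ i
  cap-idem γ i = cap-id (cap γ) i (cap-binary γ i)

  pullback : (X : MetricSpace) {A : Set} → (A → MetricSpace.Carrier X) → MetricSpace
  pullback X {A} h = record { Carrier = A ; d = λ a b → MetricSpace.d X (h a) (h b) }

  pullback-isMetric : ∀ {X : MetricSpace} {A : Set} (h : A → MetricSpace.Carrier X) →
                      IsMetric X → IsMetric (pullback X h)
  pullback-isMetric h m = record
    { d-regular  = λ a b → IsMetric.d-regular m (h a) (h b)
    ; d-nonneg   = λ a b → IsMetric.d-nonneg m (h a) (h b)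
    ; d-refl     = λ a → IsMetric.d-refl m (h a)
    ; d-sym      = λ a b → IsMetric.d-sym m (h a) (h b)
    ; d-triangle = λ a b c → IsMetric.d-triangle m (h a) (h b) (h c)
    }

  Cantor : MetricSpace
  Cantor = pullback Baire cap

  majorant : (ℕ → ℕ) → ℕ → ℕ
  majorant F zero    = F zero
  majorant F (suc j) = majorant F j ℕ.+ F (suc j)

  ≤majorant : ∀ F j → F j ≤ majorant F j
  ≤majorant F zero    = ℕP.≤-refl
  ≤majorant F (suc j) = ℕP.m≤n+m (F (suc j)) (majorant F j)

  majorant-mono : ∀ F {i j} → i ≤ j → majorant F i ≤ majorant F j
  majorant-mono F i≤j = mono′ (ℕP.≤⇒≤′ i≤j)
    where
    mono′ : ∀ {i j} → i ℕ.≤′ j → majorant F i ≤ majorant F j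
    mono′ ℕ.≤′-refl        = ℕP.≤-refl
    mono′ (ℕ.≤′-step i≤′j) = ℕP.≤-trans (mono′ i≤′j) (ℕP.m≤m+n _ _)

  -- a Cauchy sequence converges to the diagonal of its eventually stable shadows
  module Limit (s : ℕ → ℕ → ℕ) (cauchy : IsCauchy Cantor s) where
    stage : ℕ → ℕ
    stage j = proj₁ (cauchy (pow2invℝ j) (pow2invℝ-pos j))

    stage-agree : ∀ j {m n} → stage j ≤ m → stage j ≤ n → Agree (cap (s m)) (cap (s n)) j
    stage-agree j {m} {n} m≥ n≥ =
      close⇒agree (cap (s m)) (cap (s n)) j (proj₂ (cauchy (pow2invℝ j) (pow2invℝ-pos j)) m n m≥ n≥)

    limit : ℕ → ℕ
    limit i = cap (s (majorant stage (suc i))) i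

    converges : ConvergesTo Cantor s limit
    converges ε ε>0@(n₀ , _) = majorant stage n₀ , λ n n≥ →
      agree⇒close (cap (s n)) (cap limit) ε ε>0 (λ i i<n₀ → trans
        (stage-agree (suc i) (ℕP.≤-trans (≤majorant stage (suc i)) (ℕP.≤-trans (majorant-mono stage i<n₀) n≥))
                             (≤majorant stage (suc i)) i (ℕP.n<1+n i))
        (sym (cap-idem (s (majorant stage (suc i))) i)))

  Cantor-complete : IsComplete Cantor
  Cantor-complete s cauchy = Limit.limit s cauchy , Limit.converges s cauchy

  -- the zero-padded binary words of length n₀ form an ε-net, n₀ witnessing ε > 0
  Cantor-totallyBounded : IsTotallyBounded Cantor
  Cantor-totallyBounded ε ε>0@(n₀ , _) = map extend (words n₀ 2) , λ x →
    let w = initSeg (cap x) n₀ in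
    extend w ,
    ∈-map⁺ extend (subst (λ k → w ∈ words k 2)
                         (length-applyUpTo (cap x) n₀)
                         (words-complete 2 w (All.map s≤s (binary⇒path (cap x) (cap-binary x) n₀)))) ,
    agree⇒close (cap x) (cap (extend w)) ε ε>0
      (λ i i<n₀ → sym (trans (cong (ℕ._⊓ 1) (extend-initSeg (cap x) n₀ i<n₀)) (cap-idem x i)))

  CantorCompact : CompactMetricSpace
  CantorCompact = record
    { space          = Cantor
    ; isMetric       = pullback-isMetric cap Baire-isMetric
    ; complete       = Cantor-complete
    ; totallyBounded = Cantor-totallyBounded
    }

  BinaryImage : Pred (ℕ → ℕ) 0ℓ
  BinaryImage x = ∃ λ k → _≈_ Baire x (cap k)

  binaryImage-compact : IsCompactImage Baire BinaryImage
  binaryImage-compact = CantorCompact , cap , (λ ε ε>0 → ε , ε>0 , λ _ _ close → close) ,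
                        λ x → (λ x∈ → x∈) , (λ x∈ → x∈)

  path∈binaryImage : ∀ α → IsPath α → BinaryImage α
  path∈binaryImage α path = α , pointwise⇒≈ α (cap α) (λ i → sym (cap-id α i (path⇒binary α path i)))

open CantorSpace

-- For a
-- monotone bar P = ⋂ₙ Bₙ of the binary fan, a sequence γ whose first
-- non-binary entry is m + 2 at position j is tested by Bₘ(γ̄j): the test
-- answers 0 if it holds and 1 if not; binary sequences, and sequences that
-- meet P before their first non-binary entry, answer 0.  The test is
-- locally constant, and a uniform modulus N on the binary sequences forces
-- Bₘ(ᾱN) for every m and binary α, so that N bounds the bar.
module FromStrongContinuity where
  open import Level using (0ℓ)
  open import Data.Nat as ℕ using (ℕ; suc; s≤s; _≤_; _≤?_; _<?_; _∸_)
  import Data.Nat.Properties as ℕP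
  open import Data.List using (List; _++_)
  open import Data.List.Relation.Unary.All.Properties using (applyUpTo⁺₁; applyUpTo⁻)
  open import Data.Product using (∃; proj₁; proj₂)
  open import Data.Empty using (⊥-elim)
  open import Relation.Nullary using (¬_; Dec; yes; no)
  open import Relation.Unary using (Pred; Decidable)
  open import Relation.Binary.PropositionalEquality

  module BarTest (P : Pred (List ℕ) 0ℓ) (P-binary : ∀ a → P a → BinFan a)
                 (B : ℕ → Pred (List ℕ) 0ℓ) (B? : ∀ n → Decidable (B n))
                 (P⇔B : ∀ a → (P a → ∀ n → B n a) × ((∀ n → B n a) → P a))
                 (P-mono : IsMonotone P) (P-bar : IsBar P) where

    Binary : (ℕ → ℕ) → ℕ → Set
    Binary γ i = γ i ≤ 1

    binary? : ∀ γ i → Dec (Binary γ i)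
    binary? γ i = γ i ≤? 1

    P-prolong : ∀ γ {m j} → P (initSeg γ m) → m ≤ j → Below (Binary γ) j → P (initSeg γ j)
    P-prolong γ {m} {j} Pγm m≤j bin =
      subst (λ k → P (initSeg γ k)) (ℕP.m+[n∸m]≡n m≤j)
        (subst P (sym split) (P-mono (initSeg γ m) _ Pγm (subst BinFan split binary)))
      where
      split : initSeg γ (m ℕ.+ (j ∸ m)) ≡ initSeg γ m ++ initSeg (λ i → γ (m ℕ.+ i)) (j ∸ m)
      split = initSeg-+ γ m (j ∸ m)
      binary : BinFan (initSeg γ (m ℕ.+ (j ∸ m)))
      binary = subst (λ k → BinFan (initSeg γ k)) (sym (ℕP.m+[n∸m]≡n m≤j)) (applyUpTo⁺₁ γ j (λ {i} → bin i))

    barLength : (ℕ → ℕ) → ℕ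
    barLength γ = proj₁ (P-bar (cap γ) (binary⇒path (cap γ) (cap-binary γ)))

    meets-bar : ∀ γ → Below (Binary γ) (barLength γ) → P (initSeg γ (barLength γ))
    meets-bar γ bin = subst P (initSeg-cong (cap γ) γ (barLength γ) (λ i i< → cap-id γ i (bin i i<)))
                              (proj₂ (P-bar (cap γ) (binary⇒path (cap γ) (cap-binary γ))))

    -- the test of the word a at a non-binary entry v = m + 2: 0 iff Bₘ(a)
    verdict : ℕ → List ℕ → ℕ
    verdict v a with B? (v ∸ 2) a
    ... | yes _ = 0
    ... | no  _ = 1

    verdict-P : ∀ v a → P a → verdict v a ≡ 0
    verdict-P v a Pa with B? (v ∸ 2) a
    ... | yes _   = refl
    ... | no  ¬Ba = ⊥-elim (¬Ba (proj₁ (P⇔B a) Pa (v ∸ 2)))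

    verdict≡0⇒B : ∀ v a → verdict v a ≡ 0 → B (v ∸ 2) a
    verdict≡0⇒B v a eq with B? (v ∸ 2) a
    ... | yes Ba = Ba
    ... | no  _  with () ← eq

    test : (ℕ → ℕ) → ℕ
    test γ with search (binary? γ) (barLength γ)
    ... | holdsBelow _    = 0
    ... | failsAt j _ _   = verdict (γ j) (initSeg γ j)

    test-after-bar : ∀ γ J → P (initSeg γ J) → test γ ≡ 0
    test-after-bar γ J PγJ with search (binary? γ) (barLength γ)
    ... | holdsBelow _ = refl
    ... | failsAt j _ (bin , non-bin) = verdict-P (γ j) (initSeg γ j) (P-prolong γ PγJ J≤j bin)
      where
      J≤j : J ≤ j
      J≤j = failure-beyond (λ i i<J → applyUpTo⁻ γ J (P-binary _ PγJ) i<J) non-bin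

    test-at-first : ∀ γ j → FailsFirstAt (Binary γ) j → test γ ≡ verdict (γ j) (initSeg γ j)
    test-at-first γ j fails@(bin , non-bin) with search (binary? γ) (barLength γ)
    ... | holdsBelow binBar = sym (verdict-P (γ j) (initSeg γ j)
            (P-prolong γ (meets-bar γ binBar) (failure-beyond binBar non-bin) bin))
    ... | failsAt j′ _ fails′ = cong (λ k → verdict (γ k) (initSeg γ k)) (failsFirstAt-unique fails′ fails)

    firstNonBinary-agree : ∀ {y u j} → FailsFirstAt (Binary y) j → Agree y u (suc j) →
                           FailsFirstAt (Binary u) j
    firstNonBinary-agree {j = j} (bin , non-bin) ag =
        (λ i i<j → subst (_≤ 1) (ag i (ℕP.m≤n⇒m≤1+n i<j)) (bin i i<j))
      , (λ uj≤1 → non-bin (subst (_≤ 1) (sym (ag j (ℕP.n<1+n j))) uj≤1))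

    test-locallyConstant : LocallyConstant test
    test-locallyConstant y = constant-near (search (binary? y) (barLength y))
      where
      constant-near : Search (Binary y) (barLength y) → ∃ λ J → ∀ u → Agree y u J → test y ≡ test u
      constant-near (holdsBelow bin) = barLength y , λ u ag →
        trans (test-after-bar y _ (meets-bar y bin))
              (sym (test-after-bar u _ (subst P (initSeg-cong y u _ ag) (meets-bar y bin))))
      constant-near (failsAt j _ fails) = suc j , λ u ag → begin
        test y                        ≡⟨ test-at-first y j fails ⟩
        verdict (y j) (initSeg y j)   ≡⟨ cong₂ verdict (ag j (ℕP.n<1+n j))
                                                       (initSeg-cong y u j (agree-≤ (ℕP.n≤1+n j) ag)) ⟩
        verdict (u j) (initSeg u j)   ≡⟨ sym (test-at-first u j (firstNonBinary-agree fails ag)) ⟩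
        test u                        ∎
        where open ≡-Reasoning

    graft : (ℕ → ℕ) → ℕ → ℕ → ℕ → ℕ
    graft α n v i with i <? n
    ... | yes _ = α i
    ... | no  _ = v

    graft-agree : ∀ α n v → Agree α (graft α n v) n
    graft-agree α n v i i<n with i <? n
    ... | yes _   = refl
    ... | no  i≮n = ⊥-elim (i≮n i<n)

    graft-at : ∀ α n v → graft α n v n ≡ v
    graft-at α n v with n <? n
    ... | yes n<n = ⊥-elim (ℕP.<-irrefl refl n<n)
    ... | no  _   = refl

    uniform⇒barred : ∀ N → UniformModulus BinaryImage test N → ∀ α → IsPath α → P (initSeg α N)
    uniform⇒barred N modulus α path = proj₂ (P⇔B (initSeg α N)) B-holds
      where
      bin : ∀ i → Binary α i
      bin = path⇒binary α path
      B-holds : ∀ m → B m (initSeg α N)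
      B-holds m = verdict≡0⇒B (suc (suc m)) (initSeg α N) (begin
        verdict (suc (suc m)) (initSeg α N) ≡⟨ cong₂ verdict (sym (graft-at α N (suc (suc m))))
                                                             (initSeg-cong α u N (graft-agree α N _)) ⟩
        verdict (u N) (initSeg u N)         ≡⟨ sym (test-at-first u N fails) ⟩
        test u                              ≡⟨ sym (modulus α u (path∈binaryImage α path) (graft-agree α N _)) ⟩
        test α                              ≡⟨ test-after-bar α _ (meets-bar α (λ i _ → bin i)) ⟩
        0                                   ∎)
        where
        open ≡-Reasoning
        u : ℕ → ℕ
        u = graft α N (suc (suc m))
        2+m≰1 : ¬ (suc (suc m) ≤ 1)
        2+m≰1 (s≤s ())
        fails : FailsFirstAt (Binary u) N
        fails = (λ i i<N → subst (_≤ 1) (graft-agree α N _ i i<N) (bin i))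
              , (λ uN≤1 → 2+m≰1 (subst (_≤ 1) (graft-at α N (suc (suc m))) uN≤1))

  scp⇒mpb : StrongContinuityPrinciple → MonotonePi01BarPrinciple
  scp⇒mpb scp P P-binary (B , B? , _ , P⇔B) P-mono P-bar =
    N , λ α path → N , ℕP.≤-refl , uniform⇒barred N modulus α path
    where
    open BarTest P P-binary B B? P⇔B P-mono P-bar
    uniformly : ∃ λ N → UniformModulus BinaryImage test N
    uniformly = uniformOn⇒uniformModulus
      (scp test (locallyConstant⇒pointwise test test-locallyConstant)
           BinaryImage binaryImage-compact (pow2invℝ 1) (pow2invℝ-pos 1))
    N : ℕ
    N = proj₁ uniformly
    modulus : UniformModulus BinaryImage test N
    modulus = proj₂ uniformly

open FromStrongContinuity using (scp⇒mpb)

-- A compact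
-- image L = g[K] lies in a finitely branching tree: each coordinate of its
-- points is one of finitely many candidates.  Binary words code paths of
-- this tree, and the codes along which a pointwise continuous f is already
-- decided form a monotone Π⁰₁ bar; its uniform bound is a uniform modulus
-- of f on L.
module FromMonotoneBars where
  open import Level using (0ℓ)
  open import Data.Nat as ℕ using (ℕ; zero; suc; z≤n; s≤s; _≤_; _<_; _≤?_; _<?_; _∸_; _≟_)
  import Data.Nat.Properties as ℕP
  open import Data.List using (List; []; _∷_; _++_; length; map)
  open import Data.List.Relation.Unary.All as All using (All; []; _∷_; all?)
  open import Data.List.Membership.Propositional using (_∈_)
  open import Data.List.Membership.Propositional.Properties using (∈-map⁺)
  import Data.List.Properties as ListP
  open import Data.Product using (∃; proj₁; proj₂)
  open import Data.Empty using (⊥-elim)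
  open import Relation.Nullary using (yes; no)
  open import Relation.Nullary.Decidable using (_×-dec_)
  open import Relation.Unary using (Pred; Decidable)
  open import Relation.Binary.PropositionalEquality

  -- Binary codes of sequences that choose, at every level m, one of the
  -- candidates at m 0, …, at m (len m - 1).  Level m is read in unary: while
  -- the counter c is below len m a bit 1 increments it; a bit 0, or a 1 once
  -- the counter is exhausted, emits the candidate at m c and moves on.
  module Coding (len : ℕ → ℕ) (at : ℕ → ℕ → ℕ) where

    decode : ℕ → ℕ → List ℕ → List ℕ
    decode m c []           = []
    decode m c (zero ∷ bs)  = at m c ∷ decode (suc m) 0 bs
    decode m c (suc _ ∷ bs) with c <? len m
    ... | yes _ = decode m (suc c) bs
    ... | no  _ = at m c ∷ decode (suc m) 0 bs

    decode-++ : ∀ m c a b → ∃ λ r → decode m c (a ++ b) ≡ decode m c a ++ r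
    decode-++ m c []          b = decode m c b , refl
    decode-++ m c (zero ∷ a)  b with decode-++ (suc m) 0 a b
    ... | r , eq = r , cong (at m c ∷_) eq
    decode-++ m c (suc _ ∷ a) b with c <? len m
    ... | yes _ = decode-++ m (suc c) a b
    ... | no  _ with decode-++ (suc m) 0 a b
    ...   | r , eq = r , cong (at m c ∷_) eq

    -- the number of bits that surely decodes J levels from level m on
    budget : ℕ → ℕ → ℕ
    budget m zero    = 0
    budget m (suc J) = suc (len m) ℕ.+ budget (suc m) J

    budget-mono : ∀ m {I J} → I ≤ J → budget m I ≤ budget m J
    budget-mono m {zero}  _           = z≤n
    budget-mono m {suc I} (s≤s I≤J) = ℕP.+-monoʳ-≤ (suc (len m)) (budget-mono (suc m) I≤J)

    mutual
      -- inside level m with counter c: the rest of the level, then J more levels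
      decode-length′ : ∀ a m c J → (len m ∸ c) ℕ.+ suc (budget (suc m) J) ≤ length a →
                       suc J ≤ length (decode m c a)
      decode-length′ [] m c J le with () ← ℕP.≤-trans (ℕP.m≤n+m (suc (budget (suc m) J)) (len m ∸ c)) le
      decode-length′ (zero ∷ a) m c J le =
        s≤s (decode-length a (suc m) J (ℕP.≤-pred (ℕP.≤-trans (ℕP.m≤n+m _ (len m ∸ c)) le)))
      decode-length′ (suc _ ∷ a) m c J le with c <? len m
      ... | yes c<len = decode-length′ a m (suc c) J (ℕP.≤-pred
              (subst (_≤ suc (length a)) (cong (ℕ._+ suc (budget (suc m) J)) (ℕP.+-∸-assoc 1 c<len)) le))
      ... | no  c≮len = s≤s (decode-length a (suc m) J (ℕP.≤-pred
              (subst (_≤ suc (length a)) (cong (ℕ._+ suc (budget (suc m) J)) (ℕP.m≤n⇒m∸n≡0 (ℕP.≮⇒≥ c≮len))) le)))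

      decode-length : ∀ a m J → budget m J ≤ length a → J ≤ length (decode m 0 a)
      decode-length a m zero    _  = z≤n
      decode-length a m (suc J) le =
        decode-length′ a m 0 J (subst (_≤ length a) (sym (ℕP.+-suc (len m) (budget (suc m) J))) le)

    module Encoding (x : ℕ → ℕ) (idx : ℕ → ℕ) (idx<len : ∀ m → idx m < len m)
                    (at-idx : ∀ m → at m (idx m) ≡ x m) where

      encode : ℕ → ℕ → ℕ → ℕ
      encode m c zero with c <? idx m
      ... | yes _ = 1
      ... | no  _ = 0
      encode m c (suc n) with c <? idx m
      ... | yes _ = encode m (suc c) n
      ... | no  _ = encode (suc m) 0 n

      encode-binary : ∀ m c n → encode m c n ≤ 1
      encode-binary m c zero with c <? idx m
      ... | yes _ = ℕP.≤-refl
      ... | no  _ = z≤n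
      encode-binary m c (suc n) with c <? idx m
      ... | yes _ = encode-binary m (suc c) n
      ... | no  _ = encode-binary (suc m) 0 n

      decode-encode : ∀ n m c → c ≤ idx m →
        ∃ λ k → k ≤ n × decode m c (initSeg (encode m c) n) ≡ initSeg (λ j → x (m ℕ.+ j)) k
      decode-encode zero    m c _   = 0 , z≤n , refl
      decode-encode (suc n) m c c≤idx with c <? idx m
      ... | yes c<idx with c <? len m | decode-encode n m (suc c) c<idx
      ...   | yes _     | k , k≤n , eq = k , ℕP.m≤n⇒m≤1+n k≤n , eq
      ...   | no  c≮len | _ = ⊥-elim (c≮len (ℕP.<-trans c<idx (idx<len m)))
      decode-encode (suc n) m c c≤idx | no c≮idx with decode-encode n (suc m) 0 z≤n
      ... | k , k≤n , eq = suc k , s≤s k≤n , cong₂ _∷_ emitted (trans eq (shift k))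
        where
        emitted : at m c ≡ x (m ℕ.+ 0)
        emitted = trans (cong (at m) (ℕP.≤-antisym c≤idx (ℕP.≮⇒≥ c≮idx)))
                        (trans (at-idx m) (cong x (sym (ℕP.+-identityʳ m))))
        shift : ∀ k → initSeg (λ j → x (suc m ℕ.+ j)) k ≡ initSeg (λ j → x (m ℕ.+ suc j)) k
        shift k = initSeg-cong _ _ k (λ j _ → cong x (sym (ℕP.+-suc m j)))

  -- Sequences in a compact image g[K] choose their m-th entry among finitely
  -- many candidates: the m-th entries of the images of a δ-net of K, where δ
  -- makes g move points by less than 2^-(m+1).
  module Candidates (K : CompactMetricSpace) (g : CompactMetricSpace.Carrier K → ℕ → ℕ)
                    (g-uc : UniformlyContinuous (CompactMetricSpace.space K) Baire g) where
    open CompactMetricSpace K using (Carrier; d; totallyBounded)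

    g-modulus : ∀ m → ∃ λ (δ : ℝ) → Positive δ × (∀ k a → d k a <ₛ seq δ →
                      MetricSpace.d Baire (g k) (g a) <ₛ seq (pow2invℝ (suc m)))
    g-modulus m = g-uc (pow2invℝ (suc m)) (pow2invℝ-pos (suc m))

    net : ∀ m → ∃ λ (as : List Carrier) → ∀ k → ∃ λ a → a ∈ as × d k a <ₛ seq (proj₁ (g-modulus m))
    net m = totallyBounded (proj₁ (g-modulus m)) (proj₁ (proj₂ (g-modulus m)))

    candidates : ℕ → List ℕ
    candidates m = map (λ a → g a m) (proj₁ (net m))

    candidate-complete : ∀ k m → g k m ∈ candidates m
    candidate-complete k m = near (proj₂ (net m) k)
      where
      near : (∃ λ a → a ∈ proj₁ (net m) × d k a <ₛ seq (proj₁ (g-modulus m))) → g k m ∈ candidates m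
      near (a , a∈net , close) = subst (_∈ candidates m) (sym gk≡ga) (∈-map⁺ (λ a → g a m) a∈net)
        where
        gk≡ga : g k m ≡ g a m
        gk≡ga = close⇒agree (g k) (g a) (suc m) (proj₂ (proj₂ (g-modulus m)) k a close) m (ℕP.n<1+n m)

  -- For a locally constant f, a binary word is a stable code if f does not
  -- change along the prolongations of its decoding.  Stable codes form a
  -- monotone Π⁰₁ bar of the binary fan, and a uniform bound of this bar is a
  -- uniform modulus of f on the sequences that follow the candidates.
  module StableCodes (f : (ℕ → ℕ) → ℕ) (f-lc : LocallyConstant f)
                     (len : ℕ → ℕ) (at : ℕ → ℕ → ℕ) where
    open Coding len at

    Stable : List ℕ → Set
    Stable τ = ∀ t → f (extend (τ ++ t)) ≡ f (extend τ)

    stable-near : ∀ y J → (∀ u → Agree y u J → f y ≡ f u) →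
                  ∀ τ → J ≤ length τ → Agree y (extend τ) J → Stable τ
    stable-near y J constant τ J≤ ag t = trans (sym (constant _ ag′)) (constant _ ag)
      where
      ag′ : Agree y (extend (τ ++ t)) J
      ag′ i i<J = trans (ag i i<J) (sym (extend-++ τ t (ℕP.<-≤-trans i<J J≤)))

    stable⇒value : ∀ z k → Stable (initSeg z k) → f z ≡ f (extend (initSeg z k))
    stable⇒value z k stable = via (f-lc z)
      where
      via : (∃ λ J → ∀ u → Agree z u J → f z ≡ f u) → f z ≡ f (extend (initSeg z k))
      via (J , constant) = begin
        f z                                                      ≡⟨ constant _ agrees ⟩
        f (extend (initSeg z (k ℕ.+ J)))                         ≡⟨ cong (λ w → f (extend w)) (initSeg-+ z k J) ⟩
        f (extend (initSeg z k ++ initSeg (λ j → z (k ℕ.+ j)) J)) ≡⟨ stable _ ⟩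
        f (extend (initSeg z k))                                 ∎
        where
        open ≡-Reasoning
        agrees : Agree z (extend (initSeg z (k ℕ.+ J))) J
        agrees i i<J = sym (extend-initSeg z (k ℕ.+ J) (ℕP.<-≤-trans i<J (ℕP.m≤n+m J k)))

    code : List ℕ → List ℕ
    code = decode 0 0

    StableCode : Pred (List ℕ) 0ℓ
    StableCode a = BinFan a × Stable (code a)

    Checked : ℕ → Pred (List ℕ) 0ℓ
    Checked n a = BinFan a ×
      (∀ {k} → k < n → All (λ t → f (extend (code a ++ t)) ≡ f (extend (code a))) (words k n))

    checked? : ∀ n → Decidable (Checked n)
    checked? n a = All.all? (_≤? 1) a ×-dec
      ℕP.allUpTo? (λ k → all? (λ t → f (extend (code a ++ t)) ≟ f (extend (code a))) (words k n)) n

    size : List ℕ → ℕ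
    size []      = 0
    size (v ∷ t) = suc (v ℕ.+ size t)

    length≤size : ∀ t → length t ≤ size t
    length≤size []      = z≤n
    length≤size (v ∷ t) = s≤s (ℕP.≤-trans (length≤size t) (ℕP.m≤n+m (size t) v))

    letters<size : ∀ t → All (_< size t) t
    letters<size []      = []
    letters<size (v ∷ t) = s≤s (ℕP.m≤m+n v (size t))
                         ∷ All.map (λ w<s → ℕP.<-≤-trans w<s (ℕP.m≤n⇒m≤1+n (ℕP.m≤n+m (size t) v))) (letters<size t)

    stableCode-Π⁰₁ : IsΠ⁰₁ StableCode
    stableCode-Π⁰₁ = Checked , checked? , (λ n a → proj₁) , λ a →
      (λ (bin , stable) n → bin , λ _ → All.tabulate (λ {t} _ → stable t)) ,
      (λ checked → proj₁ (checked 0) , λ t →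
         All.lookup (proj₂ (checked (suc (size t))) (s≤s (length≤size t)))
                    (words-complete (suc (size t)) t (All.map ℕP.m≤n⇒m≤1+n (letters<size t))))

    stableCode-monotone : IsMonotone StableCode
    stableCode-monotone a b (_ , stable) bin = bin , prolonged (decode-++ 0 0 a b)
      where
      prolonged : (∃ λ r → code (a ++ b) ≡ code a ++ r) → Stable (code (a ++ b))
      prolonged (r , eq) = subst Stable (sym eq) λ t → begin
        f (extend ((code a ++ r) ++ t)) ≡⟨ cong (λ w → f (extend w)) (ListP.++-assoc (code a) r t) ⟩
        f (extend (code a ++ r ++ t))   ≡⟨ stable (r ++ t) ⟩
        f (extend (code a))             ≡⟨ sym (stable r) ⟩
        f (extend (code a ++ r))        ∎
        where open ≡-Reasoning

    module Decoding (β : ℕ → ℕ) where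
      decoded : ℕ → ℕ
      decoded i = extend (code (initSeg β (budget 0 (suc i)))) i

      length-code : ∀ J → J ≤ length (code (initSeg β (budget 0 J)))
      length-code J = decode-length (initSeg β (budget 0 J)) 0 J
                        (ℕP.≤-reflexive (sym (ListP.length-applyUpTo β (budget 0 J))))

      decoded-prefix : ∀ i n → budget 0 (suc i) ≤ n → extend (code (initSeg β n)) i ≡ decoded i
      decoded-prefix i n b≤n = prefix (decode-++ 0 0 (initSeg β b) (initSeg (λ j → β (b ℕ.+ j)) (n ∸ b)))
        where
        b : ℕ
        b = budget 0 (suc i)
        prefix : (∃ λ r → code (initSeg β b ++ initSeg (λ j → β (b ℕ.+ j)) (n ∸ b)) ≡ code (initSeg β b) ++ r) →
                 extend (code (initSeg β n)) i ≡ decoded i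
        prefix (r , eq) = begin
          extend (code (initSeg β n)) i
            ≡⟨ cong (λ k → extend (code (initSeg β k)) i) (sym (ℕP.m+[n∸m]≡n b≤n)) ⟩
          extend (code (initSeg β (b ℕ.+ (n ∸ b)))) i
            ≡⟨ cong (λ w → extend (code w) i) (initSeg-+ β b (n ∸ b)) ⟩
          extend (code (initSeg β b ++ initSeg (λ j → β (b ℕ.+ j)) (n ∸ b))) i
            ≡⟨ cong (λ w → extend w i) eq ⟩
          extend (code (initSeg β b) ++ r) i
            ≡⟨ extend-++ (code (initSeg β b)) r (length-code (suc i)) ⟩
          decoded i ∎
          where open ≡-Reasoning

      decoded-agree : ∀ J → Agree decoded (extend (code (initSeg β (budget 0 J)))) J
      decoded-agree J i i<J = sym (decoded-prefix i (budget 0 J) (budget-mono 0 i<J))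

    stableCode-bar : IsBar StableCode
    stableCode-bar β path = stableAt (f-lc decoded)
      where
      open Decoding β
      stableAt : (∃ λ J → ∀ u → Agree decoded u J → f decoded ≡ f u) → ∃ λ n → StableCode (initSeg β n)
      stableAt (J , constant) = budget 0 J , path (budget 0 J) ,
        stable-near decoded J constant (code (initSeg β (budget 0 J))) (length-code J) (decoded-agree J)

    Follows : (ℕ → ℕ) → Set
    Follows x = ∀ m → ∃ λ i → i < len m × at m i ≡ x m

    uniformBar⇒modulus : IsUniformBar StableCode →
                         ∃ λ N → ∀ x → Follows x → ∀ u → Agree x u N → f x ≡ f u
    uniformBar⇒modulus (N , bounded) = N , modulus
      where
      modulus : ∀ x → Follows x → ∀ u → Agree x u N → f x ≡ f u
      modulus x follows u ag =
        fromStableCode (bounded (encode 0 0) (binary⇒path (encode 0 0) (encode-binary 0 0)))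
        where
        open Encoding x (λ m → proj₁ (follows m)) (λ m → proj₁ (proj₂ (follows m)))
                        (λ m → proj₂ (proj₂ (follows m)))
        fromPrefix : ∀ {k} → k ≤ N → Stable (initSeg x k) → f x ≡ f u
        fromPrefix {k} k≤N stable = begin
          f x                       ≡⟨ stable⇒value x k stable ⟩
          f (extend (initSeg x k))  ≡⟨ cong (λ w → f (extend w)) x̄k≡ūk ⟩
          f (extend (initSeg u k))  ≡⟨ sym (stable⇒value u k (subst Stable x̄k≡ūk stable)) ⟩
          f u                       ∎
          where
          open ≡-Reasoning
          x̄k≡ūk : initSeg x k ≡ initSeg u k
          x̄k≡ūk = initSeg-cong x u k (agree-≤ k≤N ag)
        fromStableCode : (∃ λ n → n ≤ N × StableCode (initSeg (encode 0 0) n)) → f x ≡ f u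
        fromStableCode (n , n≤N , _ , stable) with decode-encode n 0 0 z≤n
        ... | k , k≤n , eq = fromPrefix (ℕP.≤-trans k≤n n≤N) (subst Stable eq stable)

  mpb⇒scp : MonotonePi01BarPrinciple → StrongContinuityPrinciple
  mpb⇒scp mpb f f-cont L (K , g , g-uc , L⇔) = uniformModulus⇒uniformOn modulus
    where
    open Candidates K g g-uc using (candidates; candidate-complete)
    len : ℕ → ℕ
    len m = length (candidates m)
    at : ℕ → ℕ → ℕ
    at m = extend (candidates m)
    open StableCodes f (pointwise⇒locallyConstant f f-cont) len at
    uniformly : ∃ λ N → ∀ x → Follows x → ∀ u → Agree x u N → f x ≡ f u
    uniformly = uniformBar⇒modulus
      (mpb StableCode (λ a → proj₁) stableCode-Π⁰₁ stableCode-monotone stableCode-bar)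
    follows : ∀ x → (∃ λ k → _≈_ Baire x (g k)) → Follows x
    follows x (k , x≈gk) m =
      extend-∈ (subst (_∈ candidates m) (sym (≈⇒pointwise x (g k) x≈gk m)) (candidate-complete k m))
    modulus : UniformModulus L f (proj₁ uniformly)
    modulus x u Lx = proj₂ uniformly x (follows x (proj₁ (L⇔ x) Lx)) u

open FromMonotoneBars using (mpb⇒scp)

proposition4p4 : (StrongContinuityPrinciple → MonotonePi01BarPrinciple) × (MonotonePi01BarPrinciple → StrongContinuityPrinciple)
proposition4p4 = scp⇒mpb , mpb⇒scp
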